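{- Let $n\ge1$ and let $a,b$ be rational numbers with $0<b-a<a<b<\frac12$ whose denominators are coprime, and for $i=1,\dots,n$ let $q^{(i)}=a^{\,n-i}b^{\,i}$ (the sequence of $n-i$ copies of $a$ followed by $i$ copies of $b$). Let $s\in\{0,1\}^{\ell}$ with $1\le\ell\le n$ contain at least one $0$ and at least one $1$. Then there exist matchings $M_1^*,\dots,M_n^*$, where $M_i^*$ is a DTW matching between $q^{(i)}$ and $s$, which are pairwise isomorphic: for all $i,i'\in[n]$, all $a'\in[\ell]$ and all $b'\in[n]$, $(q^{(i)}[b'],s[a'])\in M_i^*$ if and only if $(q^{(i')}[b'],s[a'])\in M_{i'}^*$.
   Context: A matching between sequences $q=q[1]\cdots q[m]$ and $s=s[1]\cdots s[\ell]$ is a set $M$ of edges $(q[i],s[j])$ such that: (1) every character of $q$ and of $s$ lies on at least one edge; (2) $(q[1],s[1])\in M$ and $(q[m],s[\ell])\in M$; (3) for any edges $(q[i],s[j]),(q[k],s[l])\in M$, $i>k\Rightarrow j\ge l$ and $j>l\Rightarrow i\ge k$. The cost of $M$ is $\sum_{(q[i],s[j])\in M}|q[i]-s[j]|$, and $M$ is a DTW matching if it has minimum cost among all matchings between $q$ and $s$. $[n]=\{1,\dots,n\}$. -}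

module Defs where

open import Data.Nat as ℕ using (ℕ; zero; suc; _∸_; pred)
open import Data.Fin as Fin using (Fin; toℕ)
open import Data.Bool using (Bool; true; false; if_then_else_)
open import Data.Product using (_×_)
open import Relation.Binary.PropositionalEquality using (_≡_)
open import Data.Rational using (ℚ; 0ℚ; 1ℚ; _+_; _-_; ∣_∣; _≤_)

sumFin : (m : ℕ) → (Fin m → ℚ) → ℚ
sumFin zero    f = 0ℚ
sumFin (suc m) f = f Fin.zero + sumFin m (λ i → f (Fin.suc i))

-- A candidate edge set between positions of q (length m) and s (length l):
-- M i j ≡ true  means the edge (q[i+1], s[j+1]) is in M  (0-indexed Fin positions).
EdgeSet : ℕ → ℕ → Set
EdgeSet m l = Fin m → Fin l → Bool

record IsMatching (m l : ℕ) (M : EdgeSet m l) : Set where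
  field
    coverQ : (i : Fin m) → Data.Product.Σ (Fin l) (λ j → M i j ≡ true)
    coverS : (j : Fin l) → Data.Product.Σ (Fin m) (λ i → M i j ≡ true)
    first  : (i : Fin m) (j : Fin l) → toℕ i ≡ 0 → toℕ j ≡ 0 → M i j ≡ true
    last   : (i : Fin m) (j : Fin l) → toℕ i ≡ pred m → toℕ j ≡ pred l → M i j ≡ true
    monoQ  : (i k : Fin m) (j j' : Fin l) → M i j ≡ true → M k j' ≡ true →
             toℕ k ℕ.< toℕ i → toℕ j' ℕ.≤ toℕ j
    monoS  : (i k : Fin m) (j j' : Fin l) → M i j ≡ true → M k j' ≡ true →
             toℕ j' ℕ.< toℕ j → toℕ k ℕ.≤ toℕ i

cost : (m l : ℕ) → (Fin m → ℚ) → (Fin l → ℚ) → EdgeSet m l → ℚ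
cost m l q s M = sumFin m (λ i → sumFin l (λ j → if M i j then ∣ q i - s j ∣ else 0ℚ))

IsDTWMatching : (m l : ℕ) → (Fin m → ℚ) → (Fin l → ℚ) → EdgeSet m l → Set
IsDTWMatching m l q s M =
  IsMatching m l M ×
  ((M' : EdgeSet m l) → IsMatching m l M' → cost m l q s M ≤ cost m l q s M')

bitToℚ : Bool → ℚ
bitToℚ false = 0ℚ
bitToℚ true  = 1ℚ

qSeq : (n : ℕ) → ℚ → ℚ → ℕ → Fin n → ℚ
qSeq n a b i p with toℕ p ℕ.<ᵇ (n ∸ i)
... | true  = a
... | false = b

{-# OPTIONS --safe #-}
module Submission where

-- Let J be the first position of s holding a 0 and d = n - ℓ. The staircase matching sends position
-- p of q to position max(min(p, J), p - d) of s: diagonally up to J, then the whole block q[J .. J+d]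
-- onto the 0 at s[J], then diagonally again. It does not depend on i, so it suffices to show that it
-- is a DTW matching for every q = a^(n-t) b^t.
--
-- Every edge cost splits as |q[p] - s[j]| = a·[q[p]=a] + (1-2b)·[s[j]=1] + 2(b-a)·[q[p]=b ∨ s[j]=1]
-- + (2a-b)·[q[p]=b], with nonnegative coefficients because 0 < b-a < a < b < 1/2. So it suffices to
-- show that for each of the four indicators the staircase carries at most as many edges as any
-- matching M. Every row and column of M carries an edge, while the staircase has one edge per row and
-- per 1-column; this settles three of the counts. For the edges at a b-row or a 1-column, let c be the
-- first column of the first b-row of M. If c < J, every a-row of M is matched into the 1s before J.
-- Otherwise the a-rows of M must cover the 1s left of c and the b-rows of M every column from c on,
-- and these are at least as many edges as the staircase spends there.

open import Defs
open import Data.Nat as ℕ using (ℕ; suc)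
open import Data.Nat.Coprimality using (Coprime)
open import Data.Fin using (Fin; toℕ)
open import Data.Fin.Properties using (toℕ<n)
open import Data.Bool using (Bool; true; false)
open import Data.Product using (Σ; _×_; Σ-syntax; _,_; proj₁; proj₂)
open import Relation.Binary.PropositionalEquality using (_≡_)
open import Function.Bundles using (_⇔_)
open import Function.Properties.Equivalence using () renaming (refl to ⇔-refl)

module Counting where
  open import Data.Nat.Base using (zero; suc; _+_; _∸_; _≤_; _<_; _⊔_; z≤n; s≤s; _<ᵇ_)
  open import Data.Nat.Properties
    using ( +-0-commutativeMonoid; +-mono-≤; +-comm; +-identityʳ; ≤-refl; ≤-reflexive; ≤-trans
          ; <-trans; <⇒≤; <⇒≱; ≮⇒≥; n≮0; m≤m+n; m≤n+m; m≤m⊔n; m≤n⊔m; 0∸n≡0; m∸[m∸n]≡n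
          ; m∸n≢0⇒n<m; <ᵇ⇒<; <⇒<ᵇ; _<?_; module ≤-Reasoning)
  open import Data.Fin.Base using (zero; suc)
  open import Data.Fin.Properties using (suc-injective; 0≢1+n)
  open import Data.Bool.Base using (not; _∧_; _∨_; T)
  open import Data.Bool.Properties using (¬-not; T-≡) renaming (_≟_ to _≟ᵇ_)
  open import Data.Empty using (⊥-elim)
  open import Function.Base using (_∘_)
  open import Function.Bundles using (Equivalence)
  open import Relation.Nullary.Decidable.Core using (yes; no)
  open import Relation.Binary.PropositionalEquality using (refl; sym; trans; cong; subst)
  open import Algebra.Properties.CommutativeMonoid.Sum +-0-commutativeMonoid
    using (sum; sum-cong-≗; sum-replicate-zero; ∑-distrib-+; ∑-comm) public

  ∧-true⁻ : ∀ x y → (x ∧ y) ≡ true → x ≡ true × y ≡ true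
  ∧-true⁻ true true _ = refl , refl

  ∧-true⁺ : ∀ {x y} → x ≡ true → y ≡ true → (x ∧ y) ≡ true
  ∧-true⁺ refl refl = refl

  <ᵇ≡true⇒< : ∀ {m k} → (m <ᵇ k) ≡ true → m < k
  <ᵇ≡true⇒< {m} {k} m<ᵇk = <ᵇ⇒< m k (Equivalence.from T-≡ m<ᵇk)

  <⇒<ᵇ≡true : ∀ {m k} → m < k → (m <ᵇ k) ≡ true
  <⇒<ᵇ≡true m<k = Equivalence.to T-≡ (<⇒<ᵇ m<k)

  <ᵇ≡false⇒≥ : ∀ {m k} → (m <ᵇ k) ≡ false → k ≤ m
  <ᵇ≡false⇒≥ m≮ᵇk = ≮⇒≥ λ m<k → subst T m≮ᵇk (<⇒<ᵇ m<k)

  ≥⇒<ᵇ≡false : ∀ {m k} → k ≤ m → (m <ᵇ k) ≡ false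
  ≥⇒<ᵇ≡false {m} {k} k≤m with m <ᵇ k in m<ᵇk
  ... | false = refl
  ... | true  = ⊥-elim (<⇒≱ (<ᵇ≡true⇒< m<ᵇk) k≤m)

  least-index : ∀ {m} (f : Fin m → Bool) {b} x → f x ≡ b →
    Σ[ y ∈ Fin m ] f y ≡ b × (∀ z → toℕ z < toℕ y → f z ≡ not b)
  least-index {suc m} f {b} x fx≡b with f zero ≟ᵇ b
  ... | yes f0≡b = zero , f0≡b , λ _ ()
  least-index {suc m} f {b} zero    fx≡b | no f0≢b = ⊥-elim (f0≢b fx≡b)
  least-index {suc m} f {b} (suc x) fx≡b | no f0≢b with least-index (f ∘ suc) x fx≡b
  ... | y , fy≡b , before-y = suc y , fy≡b , before-suc-y
    where
    before-suc-y : ∀ z → toℕ z < suc (toℕ y) → f z ≡ not b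
    before-suc-y zero    _         = ¬-not f0≢b
    before-suc-y (suc z) (s≤s z<y) = before-y z z<y

  sum-mono-≤ : ∀ {m} {f g : Fin m → ℕ} → (∀ x → f x ≤ g x) → sum f ≤ sum g
  sum-mono-≤ {zero}  f≤g = z≤n
  sum-mono-≤ {suc m} f≤g = +-mono-≤ (f≤g zero) (sum-mono-≤ (f≤g ∘ suc))

  ≤-sum : ∀ {m} (f : Fin m → ℕ) x → f x ≤ sum f
  ≤-sum f zero    = m≤m+n _ _
  ≤-sum f (suc x) = ≤-trans (≤-sum (f ∘ suc) x) (m≤n+m _ _)

  indicator : Bool → ℕ
  indicator true  = 1
  indicator false = 0

  indicator-∨ : ∀ x y → indicator (x ∨ y) ≤ indicator x + indicator y
  indicator-∨ true  y = s≤s z≤n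
  indicator-∨ false y = ≤-refl

  count : ∀ {m} → (Fin m → Bool) → ℕ
  count f = sum (indicator ∘ f)

  indicator-≤-count : ∀ {m} (f : Fin m → Bool) {z} →
    (z ≡ true → Σ[ x ∈ Fin m ] f x ≡ true) → indicator z ≤ count f
  indicator-≤-count f {false} _ = z≤n
  indicator-≤-count f {true} witness with witness refl
  ... | x , fx≡true = subst (λ b → indicator b ≤ count f) fx≡true (≤-sum (indicator ∘ f) x)

  count-≤-indicator : ∀ {m} (f : Fin m → Bool) {z} →
    (∀ x y → f x ≡ true → f y ≡ true → x ≡ y) → (∀ x → f x ≡ true → z ≡ true) →
    count f ≤ indicator z
  count-≤-indicator {zero}  f unique forces = z≤n
  count-≤-indicator {suc m} f unique forces with f zero in f0≡true
  ... | true  = subst (λ b → 1 + count (f ∘ suc) ≤ indicator b) (sym (forces zero f0≡true))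
                  (s≤s (count-≤-indicator (f ∘ suc) {false} (λ x y fx fy → suc-injective (unique _ _ fx fy))
                    λ x fx → ⊥-elim (0≢1+n (unique _ _ f0≡true fx))))
  ... | false = count-≤-indicator (f ∘ suc) (λ x y fx fy → suc-injective (unique _ _ fx fy)) (forces ∘ suc)

  count-≥ : ∀ m t → count {m} (λ x → not (toℕ x <ᵇ t)) ≡ m ∸ t
  count-≥ zero    t       = sym (0∸n≡0 t)
  count-≥ (suc m) zero    = cong suc (count-≥ m zero)
  count-≥ (suc m) (suc t) = count-≥ m t

  window-split : ∀ {x c u} → c < u →
    indicator (not (x <ᵇ c) ∧ (x <ᵇ u)) + indicator (not (x <ᵇ u)) ≤ indicator (not (x <ᵇ c))
  window-split {x} {c} {u} c<u with x <ᵇ c in x<ᵇc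
  ... | true rewrite <⇒<ᵇ≡true (<-trans (<ᵇ≡true⇒< x<ᵇc) c<u) = z≤n
  ... | false with x <ᵇ u
  ...   | true  = ≤-refl
  ...   | false = ≤-refl

  window-empty : ∀ {x c u} → u ≤ c → indicator (not (x <ᵇ c) ∧ (x <ᵇ u)) ≡ 0
  window-empty {x} {c} u≤c with x <ᵇ c in x<ᵇc
  ... | true  = refl
  ... | false rewrite ≥⇒<ᵇ≡false (≤-trans u≤c (<ᵇ≡false⇒≥ x<ᵇc)) = refl

  +-count-window≤ : ∀ {m} c t →
    t + count {m} (λ x → not (toℕ x <ᵇ c) ∧ (toℕ x <ᵇ m ∸ t)) ≤ count {m} (λ x → not (toℕ x <ᵇ c)) ⊔ t
  +-count-window≤ {m} c t with c <? m ∸ t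
  ... | yes c<m∸t = ≤-trans (begin
      t + count window                  ≡⟨ +-comm t (count window) ⟩
      count window + t                  ≡⟨ cong (count window +_) count-≥m∸t ⟨
      count window + count ≥m∸t         ≡⟨ ∑-distrib-+ (indicator ∘ window) (indicator ∘ ≥m∸t) ⟨
      sum {m} (λ x → indicator (window x) + indicator (≥m∸t x))
                                        ≤⟨ sum-mono-≤ {m} (λ x → window-split {toℕ x} c<m∸t) ⟩
      count ≥c                          ∎) (m≤m⊔n _ t)
    where
    open ≤-Reasoning
    window ≥c ≥m∸t : Fin m → Bool
    window x = not (toℕ x <ᵇ c) ∧ (toℕ x <ᵇ m ∸ t)
    ≥c     x = not (toℕ x <ᵇ c)
    ≥m∸t   x = not (toℕ x <ᵇ m ∸ t)
    count-≥m∸t : count ≥m∸t ≡ t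
    count-≥m∸t = trans (count-≥ m (m ∸ t))
      (m∸[m∸n]≡n (<⇒≤ (m∸n≢0⇒n<m λ m∸t≡0 → n≮0 (subst (c <_) m∸t≡0 c<m∸t))))
  ... | no c≮m∸t = ≤-trans (≤-reflexive (trans (cong (t +_) count≡0) (+-identityʳ t))) (m≤n⊔m _ t)
    where
    count≡0 : count {m} (λ x → not (toℕ x <ᵇ c) ∧ (toℕ x <ᵇ m ∸ t)) ≡ 0
    count≡0 = trans (sum-cong-≗ {m} λ x → window-empty {toℕ x} (≮⇒≥ c≮m∸t)) (sum-replicate-zero m)

module EdgeCounting {n l : ℕ} where
  open import Data.Nat.Base using (_+_; _≤_)
  open import Data.Bool.Base using (_∧_)
  open import Relation.Binary.PropositionalEquality using (sym; trans; subst)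
  open Counting

  edgesWhere : EdgeSet n l → (Fin n → Fin l → Bool) → ℕ
  edgesWhere M g = sum λ p → count λ j → M p j ∧ g p j

  edgesWhere-by-columns : ∀ M g → edgesWhere M g ≡ sum λ j → count λ p → M p j ∧ g p j
  edgesWhere-by-columns M g = ∑-comm λ p j → indicator (M p j ∧ g p j)

  edgesWhere-+ : ∀ M {g h k} →
    (∀ p j → indicator (M p j ∧ g p j) ≡ indicator (M p j ∧ h p j) + indicator (M p j ∧ k p j)) →
    edgesWhere M g ≡ edgesWhere M h + edgesWhere M k
  edgesWhere-+ M split =
    trans (sum-cong-≗ λ p → trans (sum-cong-≗ (split p)) (∑-distrib-+ {l} _ _)) (∑-distrib-+ {n} _ _)

  count-≤-edgesWhere-rows : ∀ M g {z : Fin n → Bool} →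
    (∀ p → z p ≡ true → Σ[ j ∈ Fin l ] M p j ≡ true × g p j ≡ true) → count z ≤ edgesWhere M g
  count-≤-edgesWhere-rows M g hit = sum-mono-≤ λ p → indicator-≤-count _ λ zp →
    let j , Mpj , gpj = hit p zp in j , ∧-true⁺ Mpj gpj

  count-≤-edgesWhere-columns : ∀ M g {z : Fin l → Bool} →
    (∀ j → z j ≡ true → Σ[ p ∈ Fin n ] M p j ≡ true × g p j ≡ true) → count z ≤ edgesWhere M g
  count-≤-edgesWhere-columns M g hit = subst (count {l} _ ≤_) (sym (edgesWhere-by-columns M g))
    (sum-mono-≤ λ j → indicator-≤-count _ λ zj →
      let p , Mpj , gpj = hit j zj in p , ∧-true⁺ Mpj gpj)

  edgesWhere-≤-count-rows : ∀ M g {z : Fin n → Bool} →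
    (∀ p j j′ → M p j ≡ true → M p j′ ≡ true → j ≡ j′) →
    (∀ p j → M p j ≡ true → g p j ≡ true → z p ≡ true) → edgesWhere M g ≤ count z
  edgesWhere-≤-count-rows M g unique forces = sum-mono-≤ λ p → count-≤-indicator _
    (λ j j′ e e′ → unique p j j′ (proj₁ (∧-true⁻ _ (g p j) e)) (proj₁ (∧-true⁻ _ (g p j′) e′)))
    (λ j e → let Mpj , gpj = ∧-true⁻ _ (g p j) e in forces p j Mpj gpj)

  edgesWhere-≤-count-columns : ∀ M g {z : Fin l → Bool} →
    (∀ j p p′ → M p j ≡ true → g p j ≡ true → M p′ j ≡ true → p ≡ p′) →
    (∀ j p → M p j ≡ true → g p j ≡ true → z j ≡ true) → edgesWhere M g ≤ count z
  edgesWhere-≤-count-columns M g unique forces =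
    subst (_≤ count {l} _) (sym (edgesWhere-by-columns M g)) (sum-mono-≤ λ j → count-≤-indicator _
      (λ p p′ e e′ → let Mpj , gpj = ∧-true⁻ _ (g p j) e in
                     unique j p p′ Mpj gpj (proj₁ (∧-true⁻ _ (g p′ j) e′)))
      (λ p e → let Mpj , gpj = ∧-true⁻ _ (g p j) e in forces j p Mpj gpj))

  count-≤-rowEdges : ∀ {M} → IsMatching n l M → (u : Fin n → Bool) →
    count u ≤ edgesWhere M λ p _ → u p
  count-≤-rowEdges {M} M-isMatching u =
    count-≤-edgesWhere-rows M (λ p _ → u p) λ p up → proj₁ (coverQ p) , proj₂ (coverQ p) , up
    where open IsMatching M-isMatching

  count-≤-columnEdges : ∀ {M} → IsMatching n l M → (v : Fin l → Bool) →
    count v ≤ edgesWhere M λ _ j → v j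
  count-≤-columnEdges {M} M-isMatching v =
    count-≤-edgesWhere-columns M (λ _ j → v j) λ j vj → proj₁ (coverS j) , proj₂ (coverS j) , vj
    where open IsMatching M-isMatching

module Staircase {n l : ℕ} (l≤n : l ℕ.≤ n) (J : ℕ) (J<l : J ℕ.< l) where
  open import Data.Nat.Base using (_+_; _∸_; _≤_; _<_; _⊓_; _⊔_; _≡ᵇ_; pred; z≤n; >-nonZero)
  open import Data.Nat.Properties
  open import Data.Fin.Base using (fromℕ<)
  open import Data.Fin.Properties using (toℕ-fromℕ<)
  open import Data.Bool.Properties using (T-≡)
  open import Data.Sum.Base using (inj₁; inj₂)
  open import Data.Empty using (⊥-elim)
  open import Function.Base using (_∘_)
  open import Function.Bundles using (Equivalence)
  open import Relation.Binary.Definitions using (tri<; tri≈; tri>)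
  open import Relation.Nullary.Decidable.Core using (yes; no)
  open import Relation.Binary.PropositionalEquality
    using (_≢_; sym; trans; cong; cong₂; subst; subst₂; module ≡-Reasoning)

  d : ℕ
  d = n ∸ l

  n≡d+l : n ≡ d + l
  n≡d+l = sym (m∸n+n≡m l≤n)

  stair : ℕ → ℕ
  stair p = (p ⊓ J) ⊔ (p ∸ d)

  stair-mono-≤ : ∀ {p p′} → p ≤ p′ → stair p ≤ stair p′
  stair-mono-≤ p≤p′ = ⊔-mono-≤ (⊓-mono-≤ p≤p′ ≤-refl) (∸-monoˡ-≤ d p≤p′)

  stair<l : ∀ {p} → p < n → stair p < l
  stair<l {p} p<n = ⊔-lub (≤-<-trans (m⊓n≤n p J) J<l)
    (m<n+o⇒m∸n<o p d {{>-nonZero (≤-<-trans z≤n J<l)}} (subst (p <_) n≡d+l p<n))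

  stair≡id : ∀ {p} → p ≤ J → stair p ≡ p
  stair≡id {p} p≤J rewrite m≤n⇒m⊓n≡m p≤J = m≥n⇒m⊔n≡m (m∸n≤m p d)

  stair-d+ : ∀ {x} → J ≤ x → stair (d + x) ≡ x
  stair-d+ {x} J≤x rewrite m≥n⇒m⊓n≡n (≤-trans J≤x (m≤n+m x d)) | m+n∸m≡n d x = m≤n⇒m⊔n≡n J≤x

  stair<J⇒≡ : ∀ {p} → stair p < J → p ≡ stair p
  stair<J⇒≡ {p} stair<J with p ≤? J
  ... | yes p≤J = sym (stair≡id p≤J)
  ... | no  p≰J = ⊥-elim (<⇒≱ stair<J J≤stair)
    where
    J≤stair : J ≤ stair p
    J≤stair = subst (_≤ stair p) (m≥n⇒m⊓n≡n (<⇒≤ (≰⇒> p≰J))) (m≤m⊔n (p ⊓ J) (p ∸ d))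

  J<stair⇒≡ : ∀ {p} → J < stair p → p ≡ d + stair p
  J<stair⇒≡ {p} J<stair with ⊔-sel (p ⊓ J) (p ∸ d)
  ... | inj₁ stair≡min = ⊥-elim (<⇒≱ J<stair (subst (_≤ J) (sym stair≡min) (m⊓n≤n p J)))
  ... | inj₂ stair≡p∸d with d ≤? p
  ...   | yes d≤p = trans (sym (m+[n∸m]≡n d≤p)) (cong (d +_) (sym stair≡p∸d))
  ...   | no  d≰p = ⊥-elim (n≮0 (subst (J <_) stair≡0 J<stair))
    where
    stair≡0 : stair p ≡ 0
    stair≡0 = trans stair≡p∸d (m≤n⇒m∸n≡0 (<⇒≤ (≰⇒> d≰p)))

  stair-injective : ∀ {p p′} → stair p ≡ stair p′ → stair p ≢ J → p ≡ p′
  stair-injective {p} {p′} same ≢J with <-cmp (stair p) J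
  ... | tri< <J _ _ = trans (stair<J⇒≡ <J) (trans same (sym (stair<J⇒≡ (subst (_< J) same <J))))
  ... | tri≈ _ ≡J _ = ⊥-elim (≢J ≡J)
  ... | tri> _ _ J< =
    trans (J<stair⇒≡ J<) (trans (cong (d +_) same) (sym (J<stair⇒≡ (subst (J <_) same J<))))

  stair-last : stair (pred n) ≡ pred l
  stair-last = begin
    stair (pred n)        ≡⟨ cong (stair ∘ pred) n≡d+l ⟩
    stair (pred (d + l))  ≡⟨ cong stair (pred[d+k] J<l) ⟩
    stair (d + pred l)    ≡⟨ stair-d+ (<⇒≤pred J<l) ⟩
    pred l                ∎
    where
    open ≡-Reasoning
    pred[d+k] : ∀ {k} → J < k → pred (d + k) ≡ d + pred k
    pred[d+k] {suc k} _ = cong pred (+-suc d k)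

  d+x<n∸t⇒x<l∸t : ∀ {x t} → d + x < n ∸ t → x < l ∸ t
  d+x<n∸t⇒x<l∸t {x} {t} d+x<n∸t =
    subst₂ _<_ (m+n∸m≡n d x) n∸t∸d≡l∸t (∸-monoˡ-< d+x<n∸t (m≤m+n d x))
    where
    open ≡-Reasoning
    n∸t∸d≡l∸t : n ∸ t ∸ d ≡ l ∸ t
    n∸t∸d≡l∸t = begin
      n ∸ t ∸ d          ≡⟨ ∸-+-assoc n t d ⟩
      n ∸ (t + d)        ≡⟨ cong₂ _∸_ n≡d+l (+-comm t d) ⟩
      (d + l) ∸ (d + t)  ≡⟨ [m+n]∸[m+o]≡n∸o d l t ⟩
      l ∸ t              ∎

  staircase : EdgeSet n l
  staircase p j = toℕ j ≡ᵇ stair (toℕ p)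

  staircase⁻ : ∀ {p j} → staircase p j ≡ true → toℕ j ≡ stair (toℕ p)
  staircase⁻ {p} {j} e = ≡ᵇ⇒≡ (toℕ j) (stair (toℕ p)) (Equivalence.from T-≡ e)

  staircase⁺ : ∀ {p j} → toℕ j ≡ stair (toℕ p) → staircase p j ≡ true
  staircase⁺ {p} {j} e = Equivalence.to T-≡ (≡⇒≡ᵇ (toℕ j) (stair (toℕ p)) e)

  staircase-isMatching : IsMatching n l staircase
  staircase-isMatching = record
    { coverQ = λ p → fromℕ< (stair<l (toℕ<n p)) , staircase⁺ {p} (toℕ-fromℕ< _)
    ; coverS = coverS
    ; first  = λ p j p≡0 j≡0 →
        staircase⁺ (trans j≡0 (sym (trans (cong stair p≡0) (stair≡id z≤n))))
    ; last   = λ p j p≡n-1 j≡l-1 →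
        staircase⁺ (trans j≡l-1 (sym (trans (cong stair p≡n-1) stair-last)))
    ; monoQ  = λ p k j j′ e e′ k<p →
        subst₂ _≤_ (sym (staircase⁻ e′)) (sym (staircase⁻ e)) (stair-mono-≤ (<⇒≤ k<p))
    ; monoS  = λ p k j j′ e e′ j′<j → ≮⇒≥ λ p<k →
        <⇒≱ j′<j (subst₂ _≤_ (sym (staircase⁻ e)) (sym (staircase⁻ e′)) (stair-mono-≤ (<⇒≤ p<k)))
    }
    where
    coverS : (j : Fin l) → Σ (Fin n) λ p → staircase p j ≡ true
    coverS j with toℕ j ≤? J
    ... | yes j≤J =
      fromℕ< j<n , staircase⁺ (sym (trans (cong stair (toℕ-fromℕ< j<n)) (stair≡id j≤J)))
      where
      j<n : toℕ j < n
      j<n = <-≤-trans (toℕ<n j) l≤n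
    ... | no  j≰J =
      fromℕ< d+j<n , staircase⁺ (sym (trans (cong stair (toℕ-fromℕ< d+j<n)) (stair-d+ (<⇒≤ (≰⇒> j≰J)))))
      where
      d+j<n : d + toℕ j < n
      d+j<n = subst (d + toℕ j <_) (sym n≡d+l) (+-monoʳ-< d (toℕ<n j))

module EdgeClasses (n : ℕ) {l : ℕ} (s : Fin l → Bool) (t : ℕ) where
  open import Data.Nat.Base using (_+_; _∸_; _<ᵇ_)
  open import Data.Bool.Base using (not; _∧_; _∨_)
  open import Relation.Binary.PropositionalEquality using (refl)
  open Counting using (indicator)
  open EdgeCounting

  isA : Fin n → Bool
  isA p = toℕ p <ᵇ n ∸ t

  atA atOne atB atAOne atBOrOne : Fin n → Fin l → Bool
  atA      p _ = isA p
  atOne    _ j = s j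
  atB      p _ = not (isA p)
  atAOne   p j = isA p ∧ s j
  atBOrOne p j = not (isA p) ∨ s j

  aEdges oneEdges bEdges aOneEdges bOrOneEdges : EdgeSet n l → ℕ
  aEdges      M = edgesWhere M atA
  oneEdges    M = edgesWhere M atOne
  bEdges      M = edgesWhere M atB
  aOneEdges   M = edgesWhere M atAOne
  bOrOneEdges M = edgesWhere M atBOrOne

  bOrOneEdges-split : ∀ M → bOrOneEdges M ≡ bEdges M + aOneEdges M
  bOrOneEdges-split M = edgesWhere-+ M λ p j → split (M p j) (isA p) (s j)
    where
    split : ∀ e x y → indicator (e ∧ (not x ∨ y)) ≡ indicator (e ∧ not x) + indicator (e ∧ (x ∧ y))
    split false _     _     = refl
    split true  false _     = refl
    split true  true  false = refl
    split true  true  true  = refl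

module StaircaseCounts {n l : ℕ} (l≤n : l ℕ.≤ n) (s : Fin l → Bool)
  (J : Fin l) (sJ≡false : s J ≡ false) (ones-before-J : ∀ j → toℕ j ℕ.< toℕ J → s j ≡ true)
  (t : ℕ) (0<t : 0 ℕ.< t) (t≤n : t ℕ.≤ n) where
  open import Data.Nat.Base using (_+_; _∸_; _≤_; _<_; _<ᵇ_)
  open import Data.Nat.Properties
    using ( ≤-trans; ≤-reflexive; ≤-<-trans; <⇒≱; ≮⇒≥; ≤∧≢⇒<; +-mono-≤; +-assoc; m∸[m∸n]≡n
          ; ∸-monoʳ-<; ⊔-lub; _<?_; <-cmp; module ≤-Reasoning)
  open import Data.Fin.Base using (fromℕ<)
  open import Data.Fin.Properties using (toℕ-fromℕ<; toℕ-injective)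
  open import Data.Bool.Base using (not; _∧_; _∨_)
  open import Data.Bool.Properties using (not-injective; ∨-identityʳ)
  open import Data.Empty using (⊥-elim)
  open import Function.Base using (_∘_; case_of_)
  open import Relation.Binary.Definitions using (tri<; tri≈; tri>)
  open import Relation.Nullary.Decidable.Core using (yes; no)
  open import Relation.Binary.PropositionalEquality using (_≢_; refl; sym; trans; cong; subst; subst₂)
  open Counting
  open EdgeCounting
  open Staircase l≤n (toℕ J) (toℕ<n J)
  open EdgeClasses n s t

  count-bRows : count (λ p → not (isA p)) ≡ t
  count-bRows = trans (count-≥ n (n ∸ t)) (m∸[m∸n]≡n t≤n)

  one⇒≢J : ∀ {j} → s j ≡ true → toℕ j ≢ toℕ J
  one⇒≢J {j} sj≡true j≡J with trans (sym sj≡true) (trans (cong s (toℕ-injective j≡J)) sJ≡false)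
  ... | ()

  staircase-row-unique : ∀ p j j′ → staircase p j ≡ true → staircase p j′ ≡ true → j ≡ j′
  staircase-row-unique p j j′ e e′ =
    toℕ-injective (trans (staircase⁻ {p} e) (sym (staircase⁻ {p} e′)))

  staircase-oneColumn-unique : ∀ j p p′ → s j ≡ true →
    staircase p j ≡ true → staircase p′ j ≡ true → p ≡ p′
  staircase-oneColumn-unique j p p′ sj≡true e e′ = toℕ-injective (stair-injective
    (trans (sym (staircase⁻ {p} {j} e)) (staircase⁻ {p′} {j} e′))
    (λ stair≡J → one⇒≢J sj≡true (trans (staircase⁻ {p} e) stair≡J)))

  aEdges-staircase : aEdges staircase ≤ count isA
  aEdges-staircase = edgesWhere-≤-count-rows staircase atA staircase-row-unique λ p j _ a → a

  bEdges-staircase : bEdges staircase ≤ t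
  bEdges-staircase = subst (bEdges staircase ≤_) count-bRows
    (edgesWhere-≤-count-rows staircase atB staircase-row-unique λ p j _ b → b)

  oneEdges-staircase : oneEdges staircase ≤ count s
  oneEdges-staircase = edgesWhere-≤-count-columns staircase atOne
    (λ j p p′ e one → staircase-oneColumn-unique j p p′ one e) λ j p _ one → one

  aOneEdges-staircase : aOneEdges staircase ≤ count isA
  aOneEdges-staircase = edgesWhere-≤-count-rows staircase atAOne staircase-row-unique
    λ p j _ aOne → proj₁ (∧-true⁻ (isA p) (s j) aOne)

  aOneEdges-staircase-≤window : ∀ c → toℕ J ≤ c →
    aOneEdges staircase ≤
    count {l} (λ j → not (toℕ j <ᵇ c) ∧ (toℕ j <ᵇ l ∸ t)) + count {l} (λ j → s j ∧ (toℕ j <ᵇ c))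
  aOneEdges-staircase-≤window c J≤c = begin
    aOneEdges staircase
      ≤⟨ edgesWhere-≤-count-columns staircase atAOne unique hit ⟩
    count (λ j → inWindow j ∨ oneBelow j)
      ≤⟨ sum-mono-≤ {l} (λ j → indicator-∨ (inWindow j) (oneBelow j)) ⟩
    sum (λ j → indicator (inWindow j) + indicator (oneBelow j))
      ≡⟨ ∑-distrib-+ (indicator ∘ inWindow) (indicator ∘ oneBelow) ⟩
    count inWindow + count oneBelow ∎
    where
    open ≤-Reasoning
    inWindow oneBelow : Fin l → Bool
    inWindow j = not (toℕ j <ᵇ c) ∧ (toℕ j <ᵇ l ∸ t)
    oneBelow j = s j ∧ (toℕ j <ᵇ c)

    unique : ∀ j p p′ → staircase p j ≡ true → (isA p ∧ s j) ≡ true → staircase p′ j ≡ true → p ≡ p′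
    unique j p p′ e aOne = staircase-oneColumn-unique j p p′ (proj₂ (∧-true⁻ (isA p) (s j) aOne)) e

    hit : ∀ j p → staircase p j ≡ true → (isA p ∧ s j) ≡ true → (inWindow j ∨ oneBelow j) ≡ true
    hit j p e aOne with ∧-true⁻ (isA p) (s j) aOne
    ... | a , sj≡true rewrite sj≡true with toℕ j <ᵇ c in j<ᵇc
    ...   | true  = refl
    ...   | false = trans (∨-identityʳ _)
                      (<⇒<ᵇ≡true (d+x<n∸t⇒x<l∸t {t = t} (subst (_< n ∸ t) p≡d+j (<ᵇ≡true⇒< a))))
      where
      j≡stair : toℕ j ≡ stair (toℕ p)
      j≡stair = staircase⁻ {p} e
      J<j : toℕ J < toℕ j
      J<j = ≤∧≢⇒< (≤-trans J≤c (<ᵇ≡false⇒≥ j<ᵇc)) (λ J≡j → one⇒≢J sj≡true (sym J≡j))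
      p≡d+j : toℕ p ≡ d + toℕ j
      p≡d+j = trans (J<stair⇒≡ (subst (toℕ J <_) j≡stair J<j)) (cong (d +_) (sym j≡stair))

  module _ {M : EdgeSet n l} (M-isMatching : IsMatching n l M) where
    open IsMatching M-isMatching using (coverQ; coverS; monoQ)

    t≤bEdges : t ≤ bEdges M
    t≤bEdges = subst (_≤ bEdges M) count-bRows (count-≤-rowEdges M-isMatching (λ p → not (isA p)))

    private
      n∸t<n : n ∸ t < n
      n∸t<n = ∸-monoʳ-< 0<t t≤n

      firstBRow : Fin n
      firstBRow = fromℕ< n∸t<n

      firstColumn : Σ[ c ∈ Fin l ] M firstBRow c ≡ true × (∀ j → toℕ j < toℕ c → M firstBRow j ≡ false)
      firstColumn = least-index (M firstBRow) (proj₁ (coverQ firstBRow)) (proj₂ (coverQ firstBRow))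

      c : Fin l
      c = proj₁ firstColumn

      edge-at-c : M firstBRow c ≡ true
      edge-at-c = proj₁ (proj₂ firstColumn)

      no-edge-before-c : ∀ j → toℕ j < toℕ c → M firstBRow j ≡ false
      no-edge-before-c = proj₂ (proj₂ firstColumn)

      a-row-≤c : ∀ {p j} → isA p ≡ true → M p j ≡ true → toℕ j ≤ toℕ c
      a-row-≤c {p} {j} a e =
        monoQ firstBRow p c j edge-at-c e (subst (toℕ p <_) (sym (toℕ-fromℕ< n∸t<n)) (<ᵇ≡true⇒< a))

      b-row-≥c : ∀ {p j} → isA p ≡ false → M p j ≡ true → toℕ c ≤ toℕ j
      b-row-≥c {p} {j} b e with <-cmp (toℕ firstBRow) (toℕ p)
      ... | tri< firstBRow<p _ _ = monoQ p firstBRow j c e edge-at-c firstBRow<p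
      ... | tri≈ _ firstBRow≡p _ = ≮⇒≥ λ j<c →
        case trans (sym (no-edge-before-c j j<c))
                   (subst (λ q → M q j ≡ true) (sym (toℕ-injective firstBRow≡p)) e) of λ ()
      ... | tri> _ _ p<firstBRow =
        case trans (sym b) (<⇒<ᵇ≡true (subst (toℕ p <_) (toℕ-fromℕ< n∸t<n) p<firstBRow)) of λ ()

      b-edge-from-c : ∀ j → not (toℕ j <ᵇ toℕ c) ≡ true →
        Σ[ p ∈ Fin n ] M p j ≡ true × not (isA p) ≡ true
      b-edge-from-c j j≮c with <-cmp (toℕ c) (toℕ j)
      ... | tri≈ _ c≡j _ =
        firstBRow , subst (λ k → M firstBRow k ≡ true) (toℕ-injective c≡j) edge-at-c ,
        cong not (≥⇒<ᵇ≡false (≤-reflexive (sym (toℕ-fromℕ< n∸t<n))))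
      ... | tri< c<j _ _ = proj₁ (coverS j) , proj₂ (coverS j) , cong not (b-after-c (proj₂ (coverS j)))
        where
        b-after-c : ∀ {p} → M p j ≡ true → isA p ≡ false
        b-after-c {p} e with isA p in a
        ... | false = refl
        ... | true  = ⊥-elim (<⇒≱ c<j (a-row-≤c a e))
      ... | tri> _ _ j<c = case trans (sym (<⇒<ᵇ≡true j<c)) (not-injective j≮c) of λ ()

      aOne-edge-before-c : ∀ j → (s j ∧ (toℕ j <ᵇ toℕ c)) ≡ true →
        Σ[ p ∈ Fin n ] M p j ≡ true × (isA p ∧ s j) ≡ true
      aOne-edge-before-c j e with ∧-true⁻ (s j) (toℕ j <ᵇ toℕ c) e | coverS j
      ... | sj , j<c | p , Mpj with isA p in a
      ...   | true  = p , Mpj , ∧-true⁺ a sj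
      ...   | false = ⊥-elim (<⇒≱ (<ᵇ≡true⇒< j<c) (b-row-≥c a Mpj))

      aOne-edge-in-a-row : toℕ c < toℕ J → ∀ p → isA p ≡ true →
        Σ[ j ∈ Fin l ] M p j ≡ true × (isA p ∧ s j) ≡ true
      aOne-edge-in-a-row c<J p a = proj₁ (coverQ p) , proj₂ (coverQ p) ,
        ∧-true⁺ a (ones-before-J _ (≤-<-trans (a-row-≤c a (proj₂ (coverQ p))) c<J))

    aEdges-staircase-≤ : aEdges staircase ≤ aEdges M
    aEdges-staircase-≤ = ≤-trans aEdges-staircase (count-≤-rowEdges M-isMatching isA)

    oneEdges-staircase-≤ : oneEdges staircase ≤ oneEdges M
    oneEdges-staircase-≤ = ≤-trans oneEdges-staircase (count-≤-columnEdges M-isMatching s)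

    bEdges-staircase-≤ : bEdges staircase ≤ bEdges M
    bEdges-staircase-≤ = ≤-trans bEdges-staircase t≤bEdges

    bOrOneEdges-staircase-≤ : bOrOneEdges staircase ≤ bOrOneEdges M
    bOrOneEdges-staircase-≤ =
      subst₂ _≤_ (sym (bOrOneEdges-split staircase)) (sym (bOrOneEdges-split M)) bEdges+aOneEdges
      where
      bEdges+aOneEdges : bEdges staircase + aOneEdges staircase ≤ bEdges M + aOneEdges M
      bEdges+aOneEdges with toℕ c <? toℕ J
      ... | yes c<J = +-mono-≤ bEdges-staircase-≤ (≤-trans aOneEdges-staircase
                        (count-≤-edgesWhere-rows M atAOne (aOne-edge-in-a-row c<J)))
      ... | no  c≮J = begin
        bEdges staircase + aOneEdges staircase
          ≤⟨ +-mono-≤ bEdges-staircase (aOneEdges-staircase-≤window (toℕ c) (≮⇒≥ c≮J)) ⟩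
        t + (count inWindow + count oneBelow)
          ≡⟨ +-assoc t (count inWindow) (count oneBelow) ⟨
        t + count inWindow + count oneBelow
          ≤⟨ +-mono-≤ (≤-trans (+-count-window≤ {l} (toℕ c) t)
                               (⊔-lub (count-≤-edgesWhere-columns M atB b-edge-from-c) t≤bEdges))
                      (count-≤-edgesWhere-columns M atAOne aOne-edge-before-c) ⟩
        bEdges M + aOneEdges M ∎
        where
        open ≤-Reasoning
        inWindow oneBelow : Fin l → Bool
        inWindow j = not (toℕ j <ᵇ toℕ c) ∧ (toℕ j <ᵇ l ∸ t)
        oneBelow j = s j ∧ (toℕ j <ᵇ toℕ c)

open import Data.Rational using (ℚ; 0ℚ; ½; _<_; _≤_; _-_; ↧ₙ_)

module RationalSums where
  open import Data.Nat.Base as ℕ using (zero; suc)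
  open import Data.Fin.Base using () renaming (zero to fzero; suc to fsuc)
  open import Data.Unit.Base using (tt)
  open import Data.Rational.Base using (1ℚ; _+_; _*_; -_; nonNegative)
  open import Data.Rational.Properties
    using (≤-refl; +-mono-≤; +-monoˡ-≤; +-monoʳ-≤; +-identityˡ; +-assoc; +-inverseʳ; *-monoˡ-≤-nonNeg; _≤?_)
  open import Data.Rational.Solver using (module +-*-Solver)
  open import Relation.Nullary.Decidable.Core using (toWitness)
  open import Function.Base using (_∘_)
  open import Relation.Binary.PropositionalEquality
    using (refl; sym; trans; cong; cong₂; subst; module ≡-Reasoning)
  open +-*-Solver
  open Counting using (sum)

  toℚ : ℕ → ℚ
  toℚ zero    = 0ℚ
  toℚ (suc k) = 1ℚ + toℚ k

  toℚ-+ : ∀ m k → toℚ (m ℕ.+ k) ≡ toℚ m + toℚ k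
  toℚ-+ zero    k = sym (+-identityˡ (toℚ k))
  toℚ-+ (suc m) k = trans (cong (1ℚ +_) (toℚ-+ m k)) (sym (+-assoc 1ℚ (toℚ m) (toℚ k)))

  toℚ-nonNeg : ∀ k → 0ℚ ≤ toℚ k
  toℚ-nonNeg zero    = ≤-refl
  toℚ-nonNeg (suc k) = +-mono-≤ (toWitness {a? = 0ℚ ≤? 1ℚ} tt) (toℚ-nonNeg k)

  toℚ-mono-≤ : ∀ {m k} → m ℕ.≤ k → toℚ m ≤ toℚ k
  toℚ-mono-≤ {k = k} ℕ.z≤n       = toℚ-nonNeg k
  toℚ-mono-≤         (ℕ.s≤s m≤k) = +-monoʳ-≤ 1ℚ (toℚ-mono-≤ m≤k)

  sumFin-cong : ∀ m {f g : Fin m → ℚ} → (∀ x → f x ≡ g x) → sumFin m f ≡ sumFin m g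
  sumFin-cong zero    f≡g = refl
  sumFin-cong (suc m) f≡g = cong₂ _+_ (f≡g fzero) (sumFin-cong m λ x → f≡g (fsuc x))

  p≤q⇒0≤q-p : ∀ {p q} → p ≤ q → 0ℚ ≤ q - p
  p≤q⇒0≤q-p {p} {q} p≤q = subst (_≤ q - p) (+-inverseʳ p) (+-monoˡ-≤ (- p) p≤q)

  module Combination (c₁ c₂ c₃ c₄ : ℚ) where
    combine : ℚ → ℚ → ℚ → ℚ → ℚ
    combine x₁ x₂ x₃ x₄ = c₁ * x₁ + c₂ * x₂ + c₃ * x₃ + c₄ * x₄

    combine-0 : combine 0ℚ 0ℚ 0ℚ 0ℚ ≡ 0ℚ
    combine-0 = solve 4 (λ c₁ c₂ c₃ c₄ →
      c₁ :* con 0ℚ :+ c₂ :* con 0ℚ :+ c₃ :* con 0ℚ :+ c₄ :* con 0ℚ := con 0ℚ) refl c₁ c₂ c₃ c₄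

    combine-+ : ∀ x₁ x₂ x₃ x₄ y₁ y₂ y₃ y₄ →
      combine x₁ x₂ x₃ x₄ + combine y₁ y₂ y₃ y₄ ≡ combine (x₁ + y₁) (x₂ + y₂) (x₃ + y₃) (x₄ + y₄)
    combine-+ = solve 12 (λ c₁ c₂ c₃ c₄ x₁ x₂ x₃ x₄ y₁ y₂ y₃ y₄ →
      (c₁ :* x₁ :+ c₂ :* x₂ :+ c₃ :* x₃ :+ c₄ :* x₄) :+ (c₁ :* y₁ :+ c₂ :* y₂ :+ c₃ :* y₃ :+ c₄ :* y₄)
      := c₁ :* (x₁ :+ y₁) :+ c₂ :* (x₂ :+ y₂) :+ c₃ :* (x₃ :+ y₃) :+ c₄ :* (x₄ :+ y₄)) refl c₁ c₂ c₃ c₄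

    sumFin-combine : ∀ m (f₁ f₂ f₃ f₄ : Fin m → ℕ) →
      sumFin m (λ x → combine (toℚ (f₁ x)) (toℚ (f₂ x)) (toℚ (f₃ x)) (toℚ (f₄ x))) ≡
      combine (toℚ (sum f₁)) (toℚ (sum f₂)) (toℚ (sum f₃)) (toℚ (sum f₄))
    sumFin-combine zero    f₁ f₂ f₃ f₄ = sym combine-0
    sumFin-combine (suc m) f₁ f₂ f₃ f₄ = begin
      combined fzero + sumFin m (combined ∘ fsuc)
        ≡⟨ cong (combined fzero +_) (sumFin-combine m (f₁ ∘ fsuc) (f₂ ∘ fsuc) (f₃ ∘ fsuc) (f₄ ∘ fsuc)) ⟩
      combined fzero + combine (tail-sum f₁) (tail-sum f₂) (tail-sum f₃) (tail-sum f₄)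
        ≡⟨ combine-+ _ _ _ _ _ _ _ _ ⟩
      combine (toℚ (f₁ fzero) + tail-sum f₁) (toℚ (f₂ fzero) + tail-sum f₂)
              (toℚ (f₃ fzero) + tail-sum f₃) (toℚ (f₄ fzero) + tail-sum f₄)
        ≡⟨ cong₄ (toℚ-sum f₁) (toℚ-sum f₂) (toℚ-sum f₃) (toℚ-sum f₄) ⟨
      combine (toℚ (sum f₁)) (toℚ (sum f₂)) (toℚ (sum f₃)) (toℚ (sum f₄)) ∎
      where
      open ≡-Reasoning
      combined : Fin (suc m) → ℚ
      combined x = combine (toℚ (f₁ x)) (toℚ (f₂ x)) (toℚ (f₃ x)) (toℚ (f₄ x))
      tail-sum : (Fin (suc m) → ℕ) → ℚ
      tail-sum f = toℚ (sum (f ∘ fsuc))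
      toℚ-sum : (f : Fin (suc m) → ℕ) → toℚ (sum f) ≡ toℚ (f fzero) + tail-sum f
      toℚ-sum f = toℚ-+ (f fzero) (sum (f ∘ fsuc))
      cong₄ : ∀ {x₁ x₂ x₃ x₄ y₁ y₂ y₃ y₄} → x₁ ≡ y₁ → x₂ ≡ y₂ → x₃ ≡ y₃ → x₄ ≡ y₄ →
        combine x₁ x₂ x₃ x₄ ≡ combine y₁ y₂ y₃ y₄
      cong₄ refl refl refl refl = refl

    combine-mono-≤ : 0ℚ ≤ c₁ → 0ℚ ≤ c₂ → 0ℚ ≤ c₃ → 0ℚ ≤ c₄ →
      ∀ {x₁ x₂ x₃ x₄ y₁ y₂ y₃ y₄} → x₁ ≤ y₁ → x₂ ≤ y₂ → x₃ ≤ y₃ → x₄ ≤ y₄ →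
      combine x₁ x₂ x₃ x₄ ≤ combine y₁ y₂ y₃ y₄
    combine-mono-≤ 0≤c₁ 0≤c₂ 0≤c₃ 0≤c₄ x₁≤y₁ x₂≤y₂ x₃≤y₃ x₄≤y₄ =
      +-mono-≤ (+-mono-≤ (+-mono-≤
        (*-monoˡ-≤-nonNeg c₁ {{nonNegative 0≤c₁}} x₁≤y₁)
        (*-monoˡ-≤-nonNeg c₂ {{nonNegative 0≤c₂}} x₂≤y₂))
        (*-monoˡ-≤-nonNeg c₃ {{nonNegative 0≤c₃}} x₃≤y₃))
        (*-monoˡ-≤-nonNeg c₄ {{nonNegative 0≤c₄}} x₄≤y₄)

module CostDecomposition (a b : ℚ) (0<b-a : 0ℚ < b - a) (b-a<a : b - a < a) (a<b : a < b) (b<½ : b < ½)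
  where
  open import Data.Nat.Base as ℕ using (_<ᵇ_; _∸_)
  open import Data.Bool.Base using (not; _∧_; _∨_; if_then_else_)
  open import Data.Unit.Base using (tt)
  open import Data.Rational.Base using (1ℚ; _+_; -_; ∣_∣)
  open import Data.Rational.Properties using (≤-trans; <⇒≤; <-trans; +-mono-≤; 0≤p⇒∣p∣≡p; ∣-p∣≡∣p∣; _≤?_)
  open import Data.Rational.Solver using (module +-*-Solver)
  open import Relation.Nullary.Decidable.Core using (toWitness)
  open import Relation.Binary.PropositionalEquality using (refl; sym; trans; cong; subst₂)
  open +-*-Solver
  open Counting using (indicator)
  open RationalSums
  open Combination a (1ℚ - (b + b)) ((b - a) + (b - a)) (a - (b - a))

  0≤a : 0ℚ ≤ a
  0≤a = <⇒≤ (<-trans 0<b-a b-a<a)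

  0≤b : 0ℚ ≤ b
  0≤b = ≤-trans 0≤a (<⇒≤ a<b)

  b≤1 : b ≤ 1ℚ
  b≤1 = ≤-trans (<⇒≤ b<½) (toWitness {a? = ½ ≤? 1ℚ} tt)

  a≤1 : a ≤ 1ℚ
  a≤1 = ≤-trans (<⇒≤ a<b) b≤1

  ∣p-0∣≡p : ∀ {p} → 0ℚ ≤ p → ∣ p - 0ℚ ∣ ≡ p
  ∣p-0∣≡p {p} 0≤p = trans (cong ∣_∣ (solve 1 (λ p → p :- con 0ℚ := p) refl p)) (0≤p⇒∣p∣≡p 0≤p)

  ∣p-1∣≡1-p : ∀ {p} → p ≤ 1ℚ → ∣ p - 1ℚ ∣ ≡ 1ℚ - p
  ∣p-1∣≡1-p {p} p≤1 = trans (cong ∣_∣ (solve 1 (λ p → p :- con 1ℚ := :- (con 1ℚ :- p)) refl p))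
                            (trans (∣-p∣≡∣p∣ (1ℚ - p)) (0≤p⇒∣p∣≡p (p≤q⇒0≤q-p p≤1)))

  χ : Bool → ℚ
  χ x = toℚ (indicator x)

  letterDistance-combination : ∀ x y →
    ∣ (if x then a else b) - bitToℚ y ∣ ≡ combine (χ x) (χ y) (χ (not x ∨ y)) (χ (not x))
  letterDistance-combination true false = trans (∣p-0∣≡p 0≤a) (solve 2 (λ a b →
    a := a :* con 1ℚ :+ (con 1ℚ :- (b :+ b)) :* con 0ℚ
           :+ ((b :- a) :+ (b :- a)) :* con 0ℚ :+ (a :- (b :- a)) :* con 0ℚ) refl a b)
  letterDistance-combination true true = trans (∣p-1∣≡1-p a≤1) (solve 2 (λ a b →
    con 1ℚ :- a := a :* con 1ℚ :+ (con 1ℚ :- (b :+ b)) :* con 1ℚ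
                    :+ ((b :- a) :+ (b :- a)) :* con 1ℚ :+ (a :- (b :- a)) :* con 0ℚ) refl a b)
  letterDistance-combination false false = trans (∣p-0∣≡p 0≤b) (solve 2 (λ a b →
    b := a :* con 0ℚ :+ (con 1ℚ :- (b :+ b)) :* con 0ℚ
           :+ ((b :- a) :+ (b :- a)) :* con 1ℚ :+ (a :- (b :- a)) :* con 1ℚ) refl a b)
  letterDistance-combination false true = trans (∣p-1∣≡1-p b≤1) (solve 2 (λ a b →
    con 1ℚ :- b := a :* con 0ℚ :+ (con 1ℚ :- (b :+ b)) :* con 1ℚ
                    :+ ((b :- a) :+ (b :- a)) :* con 1ℚ :+ (a :- (b :- a)) :* con 1ℚ) refl a b)

  edgeCost-combination : ∀ e x y →
    (if e then ∣ (if x then a else b) - bitToℚ y ∣ else 0ℚ) ≡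
    combine (χ (e ∧ x)) (χ (e ∧ y)) (χ (e ∧ (not x ∨ y))) (χ (e ∧ not x))
  edgeCost-combination false x y = sym combine-0
  edgeCost-combination true  x y = letterDistance-combination x y

  module _ (n l : ℕ) (s : Fin l → Bool) (t : ℕ) where
    open EdgeClasses n s t

    qSeq≡ : ∀ p → qSeq n a b t p ≡ (if isA p then a else b)
    qSeq≡ p with toℕ p <ᵇ n ∸ t
    ... | true  = refl
    ... | false = refl

    cost≡combination : ∀ M → cost n l (qSeq n a b t) (λ j → bitToℚ (s j)) M ≡
      combine (toℚ (aEdges M)) (toℚ (oneEdges M)) (toℚ (bOrOneEdges M)) (toℚ (bEdges M))
    cost≡combination M = trans
      (sumFin-cong n λ p → trans
        (sumFin-cong l λ j → trans (cong (λ q → if M p j then ∣ q - bitToℚ (s j) ∣ else 0ℚ) (qSeq≡ p))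
                                   (edgeCost-combination (M p j) (isA p) (s j)))
        (sumFin-combine l _ _ _ _))
      (sumFin-combine n _ _ _ _)

    cost-mono-≤ : ∀ {M M′} → aEdges M ℕ.≤ aEdges M′ → oneEdges M ℕ.≤ oneEdges M′ →
      bOrOneEdges M ℕ.≤ bOrOneEdges M′ → bEdges M ℕ.≤ bEdges M′ →
      cost n l (qSeq n a b t) (λ j → bitToℚ (s j)) M ≤ cost n l (qSeq n a b t) (λ j → bitToℚ (s j)) M′
    cost-mono-≤ {M} {M′} a≤ one≤ bOrOne≤ b≤ =
      subst₂ _≤_ (sym (cost≡combination M)) (sym (cost≡combination M′))
        (combine-mono-≤ 0≤a 0≤1-2b 0≤2[b-a] 0≤2a-b
          (toℚ-mono-≤ a≤) (toℚ-mono-≤ one≤) (toℚ-mono-≤ bOrOne≤) (toℚ-mono-≤ b≤))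
      where
      0≤1-2b : 0ℚ ≤ 1ℚ - (b + b)
      0≤1-2b = p≤q⇒0≤q-p (+-mono-≤ (<⇒≤ b<½) (<⇒≤ b<½))
      0≤2[b-a] : 0ℚ ≤ (b - a) + (b - a)
      0≤2[b-a] = +-mono-≤ (<⇒≤ 0<b-a) (<⇒≤ 0<b-a)
      0≤2a-b : 0ℚ ≤ a - (b - a)
      0≤2a-b = p≤q⇒0≤q-p (<⇒≤ b-a<a)

mainTheorem15 : (n : ℕ) → 1 ℕ.≤ n → (a b : ℚ) →
    0ℚ < b - a → b - a < a → a < b → b < ½ → Coprime (↧ₙ a) (↧ₙ b) →
    (l : ℕ) → 1 ℕ.≤ l → l ℕ.≤ n → (s : Fin l → Bool) →
    Σ (Fin l) (λ j → s j ≡ false) → Σ (Fin l) (λ j → s j ≡ true) →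
    Σ (Fin n → EdgeSet n l) (λ M →
      ((i : Fin n) → IsDTWMatching n l (qSeq n a b (suc (toℕ i))) (λ j → bitToℚ (s j)) (M i)) ×
      ((i i' : Fin n) (a' : Fin l) (b' : Fin n) → (M i b' a' ≡ true) ⇔ (M i' b' a' ≡ true)))
mainTheorem15 n _ a b 0<b-a b-a<a a<b b<½ _ l _ l≤n s (j , sj≡false) _ =
  (λ _ → staircase) , (λ i → staircase-isMatching , optimal i) , λ _ _ _ _ → ⇔-refl
  where
  firstZero : Σ[ J ∈ Fin l ] s J ≡ false × (∀ j → toℕ j ℕ.< toℕ J → s j ≡ true)
  firstZero = Counting.least-index s j sj≡false

  J : Fin l
  J = proj₁ firstZero

  open Staircase l≤n (toℕ J) (toℕ<n J)

  optimal : (i : Fin n) (M : EdgeSet n l) → IsMatching n l M →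
    cost n l (qSeq n a b (suc (toℕ i))) (λ j → bitToℚ (s j)) staircase ≤
    cost n l (qSeq n a b (suc (toℕ i))) (λ j → bitToℚ (s j)) M
  optimal i M M-isMatching = CostDecomposition.cost-mono-≤ a b 0<b-a b-a<a a<b b<½ n l s (suc (toℕ i))
    (aEdges-staircase-≤ M-isMatching) (oneEdges-staircase-≤ M-isMatching)
    (bOrOneEdges-staircase-≤ M-isMatching) (bEdges-staircase-≤ M-isMatching)
    where
    open StaircaseCounts l≤n s J (proj₁ (proj₂ firstZero)) (proj₂ (proj₂ firstZero))
                         (suc (toℕ i)) (ℕ.s≤s ℕ.z≤n) (toℕ<n i)
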